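{- Let $P$ be a finite definite propositional logic program, and let $\mathit{complete}$ be any procedure that, given a definite program $Q$ with $Q\neq\emptyset$, returns a collection of sets of literals that is complete for $Q$. Consider the recursive algorithm $\mathit{stable}(P,L)$, for $L\subseteq \mathit{Lit}(P)$: (0) if $L$ is consistent then (1) if $[P]_L=\emptyset$ then (2) check whether $L^+$ is a stable model of $P$ and, if so, output it; (3) else (4) $\mathcal A:=\mathit{complete}([P]_L)$; (5) for every $A\in\mathcal A$ do (6) call $\mathit{stable}(P,L\cup A)$. Then for every $L\subseteq \mathit{Lit}(P)$, the call $\mathit{stable}(P,L)$ outputs exactly the stable models of $P$ that are consistent with $L$.
   Context: A clause is an expression $p\leftarrow B$ (definite clause) or $\leftarrow B$ (constraint), where $p$ is an atom (the head $h(c)$) and $B$ is a finite set of literals (atoms $a$ or negated atoms $\mathrm{not}(a)$), no literal repeated. $b^+(c)$ is the set of atoms occurring positively in the body, $b^-(c)$ the set of atoms occurring negated in the body. A logic program is a finite set of clauses; it is definite if all its clauses are definite. $\mathit{At}(P)$ is the set of atoms appearing in $P$ and $\mathit{Lit}(P)=\mathit{At}(P)\cup\{\mathrm{not}(a): a\in\mathit{At}(P)\}$. A set $M\subseteq\mathit{At}(P)$ is a stable model of $P$ (Gelfond–Lifschitz) if $M$ satisfies every constraint of $P$ and $M$ is the least model of the reduct $P^M$, obtained from the definite clauses of $P$ by deleting every clause $c$ with $b^-(c)\cap M\neq\emptyset$ and deleting all negated literals from the bodies of the remaining clauses. For $L\subseteq\mathit{Lit}(P)$: $L^+=\{a: a\in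 L\}$, $L^-=\{a:\mathrm{not}(a)\in L\}$, $L^0=L^+\cup L^-$; $L$ is consistent if $L^+\cap L^-=\emptyset$; a set of atoms $M$ is consistent with $L$ if $L^+\subseteq M$ and $L^-\cap M=\emptyset$. The simplification $[P]_L$ is obtained from $P$ by removing every clause $c$ with $b^+(c)\cap L^-\neq\emptyset$, every clause with $b^-(c)\cap L^+\neq\emptyset$, every clause with $h(c)\in L^0$, and then removing every occurrence of a literal of $L$ from the bodies of the remaining clauses. A nonempty collection $\mathcal A$ of nonempty subsets of $\mathit{Lit}(Q)$ is complete for a program $Q$ if every stable model of $Q$ is consistent with at least one $A\in\mathcal A$. -}

module Defs where

open import Level using (0ℓ)
open import Data.Nat using (ℕ; _≡ᵇ_)
open import Data.Bool using (Bool; true; false; _∨_; not)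
open import Data.Maybe using (Maybe; just; nothing; Is-just)
open import Data.List using (List; []; _∷_; filter; map; _++_)
open import Data.Bool.ListAction using (any)
open import Data.List.Relation.Unary.All using (All)
open import Data.List.Relation.Unary.Any using (Any)
open import Data.List.Membership.Propositional using (_∈_)
open import Data.Product using (Σ; _×_; ∃)
open import Data.Empty using (⊥)
open import Relation.Nullary using (¬_)
open import Relation.Binary.PropositionalEquality using (_≡_; _≢_)
open import Data.Bool using (T)

data Literal : Set where
  pos : ℕ → Literal
  neg : ℕ → Literal

atomOf : Literal → ℕ
atomOf (pos a) = a
atomOf (neg a) = a

-- A clause: head = just p  (definite clause p ← B)
--           head = nothing (constraint ← B)
record Clause : Set where
  constructor _⇐_
  field
    head : Maybe ℕ
    body : List Literal
open Clause public

Program : Set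
Program = List Clause

Definite : Program → Set
Definite P = All (λ c → Is-just (head c)) P

AtomSet : Set₁
AtomSet = ℕ → Set

_⊆ₐ_ : AtomSet → AtomSet → Set
M ⊆ₐ N = ∀ a → M a → N a

_≐_ : AtomSet → AtomSet → Set
M ≐ N = M ⊆ₐ N × N ⊆ₐ M

OccursIn : ℕ → Clause → Set
OccursIn a c = (head c ≡ just a) Data.Sum.⊎ Any (λ l → atomOf l ≡ a) (body c)
  where import Data.Sum

At : Program → AtomSet
At P a = Any (OccursIn a) P

InLit : Program → Literal → Set
InLit P l = At P (atomOf l)

_⊆Lit_ : List Literal → Program → Set
L ⊆Lit P = ∀ l → l ∈ L → InLit P l

Pos : List Literal → AtomSet
Pos L a = pos a ∈ L

Consistent : List Literal → Set
Consistent L = ∀ a → pos a ∈ L → neg a ∈ L → ⊥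

ConsistentWith : AtomSet → List Literal → Set
ConsistentWith M L = (∀ a → pos a ∈ L → M a) × (∀ a → neg a ∈ L → ¬ M a)

Holds : AtomSet → Literal → Set
Holds M (pos a) = M a
Holds M (neg a) = ¬ M a

SatConstraints : Program → AtomSet → Set
SatConstraints P M = ∀ c → c ∈ P → head c ≡ nothing → ¬ All (Holds M) (body c)

record PosClause : Set where
  constructor _←⁺_
  field
    phead : ℕ
    pbody : List ℕ
open PosClause public

b⁺ : Clause → List ℕ
b⁺ c = go (body c)
  where
  go : List Literal → List ℕ
  go [] = []
  go (pos a ∷ ls) = a ∷ go ls
  go (neg a ∷ ls) = go ls

b⁻ : Clause → List ℕ
b⁻ c = go (body c)
  where
  go : List Literal → List ℕ
  go [] = []
  go (pos a ∷ ls) = go ls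
  go (neg a ∷ ls) = a ∷ go ls

Reduct : Program → AtomSet → PosClause → Set
Reduct P M d = Σ Clause λ c → c ∈ P × head c ≡ just (phead d)
                 × pbody d ≡ b⁺ c × All (λ a → ¬ M a) (b⁻ c)

IsModel : (PosClause → Set) → AtomSet → Set
IsModel R N = ∀ d → R d → All N (pbody d) → N (phead d)

LeastModel : (PosClause → Set) → AtomSet → Set₁
LeastModel R M = IsModel R M × (∀ (N : AtomSet) → IsModel R N → M ⊆ₐ N)

StableModel : Program → AtomSet → Set₁
StableModel P M = (M ⊆ₐ At P) × SatConstraints P M × LeastModel (Reduct P M) M

_==ₗ_ : Literal → Literal → Bool
pos a ==ₗ pos b = a ≡ᵇ b
neg a ==ₗ neg b = a ≡ᵇ b
pos _ ==ₗ neg _ = false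
neg _ ==ₗ pos _ = false

elemᵇ : Literal → List Literal → Bool
elemᵇ l L = any (l ==ₗ_) L

clashᵇ : List Literal → Literal → Bool
clashᵇ L (pos a) = elemᵇ (neg a) L
clashᵇ L (neg a) = elemᵇ (pos a) L

headInᵇ : List Literal → Maybe ℕ → Bool
headInᵇ L nothing  = false
headInᵇ L (just a) = elemᵇ (pos a) L ∨ elemᵇ (neg a) L

removedᵇ : List Literal → Clause → Bool
removedᵇ L c = any (clashᵇ L) (body c) ∨ headInᵇ L (head c)

simplify : Program → List Literal → Program
simplify P L =
  map (λ c → head c ⇐ filter (λ l → Data.Bool.Properties.T? (not (elemᵇ l L))) (body c))
      (filter (λ c → Data.Bool.Properties.T? (not (removedᵇ L c))) P)
  where import Data.Bool.Properties

Complete : Program → List (List Literal) → Set₁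
Complete Q 𝒜 = (𝒜 ≢ []) × All (λ A → (A ≢ []) × (A ⊆Lit Q)) 𝒜
             × (∀ (M : AtomSet) → StableModel Q M → Any (ConsistentWith M) 𝒜)

-- The algorithm stable(P, L), modelled by the relation
-- "Outputs P complete L M" = the call stable(P,L) outputs M
-- (at some point of its recursive execution).

data Outputs (P : Program) (complete : Program → List (List Literal))
     : List Literal → AtomSet → Set₁ where
  -- lines (0)-(2)
  out-base : ∀ {L} → Consistent L → simplify P L ≡ []
           → StableModel P (Pos L) → Outputs P complete L (Pos L)
  -- lines (0),(3)-(6)
  out-rec  : ∀ {L A M} → Consistent L → simplify P L ≢ []
           → A ∈ complete (simplify P L)
           → Outputs P complete (L ++ A) M → Outputs P complete L M

{-# OPTIONS --safe #-}
module Submission where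

-- Soundness: every output is checked to be a stable model, and L only grows
-- along the recursion. Completeness: if M is a stable model of P consistent
-- with L, then M ∩ At([P]_L) is a stable model of [P]_L, so the collection
-- returned by complete contains some A with M consistent with L ∪ A. As A is a
-- nonempty set of literals over atoms of [P]_L, which L does not mention, each
-- call covers a new atom of P and the recursion is well founded. Once
-- [P]_L = ∅, every clause of the reduct P^M whose body holds in L⁺ ⊆ M was
-- removed because of its head, which must lie in L⁺ since M is a model of P^M;
-- so L⁺ is a model of P^M and the minimality of M gives M = L⁺.

open import Defs
open import Data.Bool using (true; false; not; T; _∨_)
open import Data.Bool.ListAction using (any)
open import Data.Bool.Properties using (T?; T-∨)
open import Data.Empty using (⊥-elim)
open import Data.List using (List; []; _∷_; _++_; filter; length; map; concatMap; fromMaybe)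
open import Data.List.Membership.Propositional using (_∈_; _∉_; find; lose)
open import Data.List.Membership.Propositional.Properties
  using (∈-filter⁻; ∈-filter⁺; ∈-map⁻; ∈-map⁺; ∈-++⁺ˡ; ∈-++⁺ʳ; ∈-++⁻; ∈-concatMap⁺)
open import Data.List.Relation.Unary.All as All using (All; []; _∷_)
import Data.List.Relation.Unary.All.Properties as Allₚ
open import Data.List.Relation.Unary.Any as Any using (Any; here; there)
open import Data.List.Relation.Unary.Any.Properties using (any⁺; any⁻; ¬Any[]; map⁺)
open import Data.Maybe using (just)
open import Data.Nat using (ℕ; _≤_; _<_; z≤n; s≤s)
open import Data.Nat.Induction using (<-wellFounded)
open import Data.Nat.Properties using (≡ᵇ⇒≡; ≡⇒≡ᵇ; m≤n⇒m≤1+n)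
open import Data.Product using (Σ; ∃-syntax; _×_; _,_; proj₁; proj₂)
open import Data.Sum using (_⊎_; inj₁; inj₂; [_,_]′)
open import Function.Base using (_∘_; case_of_)
open import Function.Bundles using (_⇔_; mk⇔; Equivalence)
open import Induction.WellFounded using (Acc; acc)
open import Relation.Binary.PropositionalEquality using (_≡_; _≢_; refl; sym; trans; cong; subst)
open import Relation.Nullary using (¬_; yes; no)
open import Relation.Nullary.Decidable using (map′; ¬?)
open import Relation.Unary using (Pred; Decidable; _∩_)

T-not⁺ : ∀ {b} → ¬ T b → T (not b)
T-not⁺ {true}  ¬b = ¬b _
T-not⁺ {false} _  = _

T-not⁻ : ∀ {b} → T (not b) → ¬ T b
T-not⁻ {true} ()

==ₗ⇒≡ : ∀ l l′ → T (l ==ₗ l′) → l ≡ l′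
==ₗ⇒≡ (pos a) (pos b) t = cong pos (≡ᵇ⇒≡ a b t)
==ₗ⇒≡ (neg a) (neg b) t = cong neg (≡ᵇ⇒≡ a b t)

==ₗ-refl : ∀ l → T (l ==ₗ l)
==ₗ-refl (pos a) = ≡⇒≡ᵇ a a refl
==ₗ-refl (neg a) = ≡⇒≡ᵇ a a refl

elemᵇ⁻ : ∀ {l} L → T (elemᵇ l L) → l ∈ L
elemᵇ⁻ {l} L t = Any.map (==ₗ⇒≡ l _) (any⁻ (l ==ₗ_) L t)

elemᵇ⁺ : ∀ {l L} → l ∈ L → T (elemᵇ l L)
elemᵇ⁺ {l} l∈L = any⁺ (l ==ₗ_) (Any.map (λ { refl → ==ₗ-refl l }) l∈L)

-- The simplification [P]_L

negate : Literal → Literal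
negate (pos a) = neg a
negate (neg a) = pos a

Covered : List Literal → Pred ℕ _
Covered L a = pos a ∈ L ⊎ neg a ∈ L

covered⁻ : ∀ L {a} → T (elemᵇ (pos a) L ∨ elemᵇ (neg a) L) → Covered L a
covered⁻ L {a} t with Equivalence.to (T-∨ {elemᵇ (pos a) L}) t
... | inj₁ t⁺ = inj₁ (elemᵇ⁻ L t⁺)
... | inj₂ t⁻ = inj₂ (elemᵇ⁻ L t⁻)

covered⁺ : ∀ {L a} → Covered L a → T (elemᵇ (pos a) L ∨ elemᵇ (neg a) L)
covered⁺ {L} {a} (inj₁ a∈L) = Equivalence.from (T-∨ {elemᵇ (pos a) L}) (inj₁ (elemᵇ⁺ a∈L))
covered⁺ {L} {a} (inj₂ a∈L) = Equivalence.from (T-∨ {elemᵇ (pos a) L}) (inj₂ (elemᵇ⁺ a∈L))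

Covered? : ∀ L → Decidable (Covered L)
Covered? L a = map′ (covered⁻ L) covered⁺ (T? _)

∈⇒Covered : ∀ {l L} → l ∈ L → Covered L (atomOf l)
∈⇒Covered {pos a} l∈L = inj₁ l∈L
∈⇒Covered {neg a} l∈L = inj₂ l∈L

Covered-++⁺ˡ : ∀ {L a} A → Covered L a → Covered (L ++ A) a
Covered-++⁺ˡ A (inj₁ a∈L) = inj₁ (∈-++⁺ˡ a∈L)
Covered-++⁺ˡ A (inj₂ a∈L) = inj₂ (∈-++⁺ˡ a∈L)

data Removed (L : List Literal) (c : Clause) : Set where
  clash : ∀ {l} → l ∈ body c → negate l ∈ L → Removed L c
  fixed : ∀ {h} → head c ≡ just h → Covered L h → Removed L c

clashᵇ⁻ : ∀ L l → T (clashᵇ L l) → negate l ∈ L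
clashᵇ⁻ L (pos a) = elemᵇ⁻ L
clashᵇ⁻ L (neg a) = elemᵇ⁻ L

clashᵇ⁺ : ∀ {L} l → negate l ∈ L → T (clashᵇ L l)
clashᵇ⁺ (pos a) = elemᵇ⁺
clashᵇ⁺ (neg a) = elemᵇ⁺

removedᵇ⁻ : ∀ L c → T (removedᵇ L c) → Removed L c
removedᵇ⁻ L (h ⇐ ls) t with Equivalence.to (T-∨ {any (clashᵇ L) ls}) t
... | inj₁ t-clash with find (any⁻ (clashᵇ L) ls t-clash)
...   | l , l∈ls , t-l = clash l∈ls (clashᵇ⁻ L l t-l)
removedᵇ⁻ L (just h ⇐ ls) t | inj₂ t-head = fixed refl (covered⁻ L t-head)

removedᵇ⁺ : ∀ {L c} → Removed L c → T (removedᵇ L c)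
removedᵇ⁺ {L} {c} (clash {l} l∈ nl) =
  Equivalence.from (T-∨ {any (clashᵇ L) (body c)}) (inj₁ (any⁺ (clashᵇ L) (lose l∈ (clashᵇ⁺ l nl))))
removedᵇ⁺ {L} {just h ⇐ ls} (fixed refl cov) =
  Equivalence.from (T-∨ {any (clashᵇ L) ls}) (inj₂ (covered⁺ cov))

Removed? : ∀ L → Decidable (Removed L)
Removed? L c = map′ (removedᵇ⁻ L c) removedᵇ⁺ (T? _)

simplifyClause : List Literal → Clause → Clause
simplifyClause L c = head c ⇐ filter (λ l → T? (not (elemᵇ l L))) (body c)

∈-simplify⁻ : ∀ P L {c′} → c′ ∈ simplify P L →
              ∃[ c ] c ∈ P × ¬ Removed L c × c′ ≡ simplifyClause L c
∈-simplify⁻ P L c′∈ with ∈-map⁻ (simplifyClause L) c′∈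
... | c , c∈ , refl with ∈-filter⁻ (λ c → T? (not (removedᵇ L c))) c∈
...   | c∈P , kept = c , c∈P , T-not⁻ kept ∘ removedᵇ⁺ , refl

∈-simplify⁺ : ∀ P L {c} → c ∈ P → ¬ Removed L c → simplifyClause L c ∈ simplify P L
∈-simplify⁺ P L c∈P ¬rem =
  ∈-map⁺ (simplifyClause L) (∈-filter⁺ (λ c → T? (not (removedᵇ L c))) c∈P (T-not⁺ (¬rem ∘ removedᵇ⁻ L _)))

∈-simplifyClause⁻ : ∀ L c {l} → l ∈ body (simplifyClause L c) → l ∈ body c × l ∉ L
∈-simplifyClause⁻ L c l∈ with ∈-filter⁻ (λ l → T? (not (elemᵇ l L))) l∈
... | l∈c , kept = l∈c , T-not⁻ kept ∘ elemᵇ⁺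

∈-simplifyClause⁺ : ∀ L c {l} → l ∈ body c → l ∈ L ⊎ l ∈ body (simplifyClause L c)
∈-simplifyClause⁺ L c {l} l∈c with T? (elemᵇ l L)
... | yes t = inj₁ (elemᵇ⁻ L t)
... | no ¬t = inj₂ (∈-filter⁺ (λ l → T? (not (elemᵇ l L))) l∈c (T-not⁺ ¬t))

head-At : ∀ {P c h} → c ∈ P → head c ≡ just h → At P h
head-At c∈P h≡ = lose c∈P (inj₁ h≡)

body-At : ∀ {P c l} → c ∈ P → l ∈ body c → At P (atomOf l)
body-At c∈P l∈c = lose c∈P (inj₂ (lose l∈c refl))

At-simplify⁻ : ∀ P L {a} → At (simplify P L) a → At P a × ¬ Covered L a
At-simplify⁻ P L at with find at
... | c′ , c′∈ , occ with ∈-simplify⁻ P L c′∈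
...   | c , c∈P , ¬rem , refl with occ
...     | inj₁ h≡ = head-At c∈P h≡ , ¬rem ∘ fixed h≡
...     | inj₂ occ-body with find occ-body
...       | l , l∈ , refl with ∈-simplifyClause⁻ L c l∈
...         | l∈c , l∉L = body-At c∈P l∈c , ¬covered l l∈c l∉L
  where
  ¬covered : ∀ l → l ∈ body c → l ∉ L → ¬ Covered L (atomOf l)
  ¬covered (pos a) l∈c l∉L = [ l∉L , ¬rem ∘ clash l∈c ]′
  ¬covered (neg a) l∈c l∉L = [ ¬rem ∘ clash l∈c , l∉L ]′

simplify-definite : ∀ {P} L → Definite P → Definite (simplify P L)
simplify-definite L P-def = Allₚ.map⁺ (Allₚ.filter⁺ (λ c → T? (not (removedᵇ L c))) P-def)

-- Reducts and stable models

-- ReductHolds M N l: the literal l, read in the reduct P^M, holds in N.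
data ReductHolds (M N : AtomSet) : Literal → Set where
  pos : ∀ {a} → N a → ReductHolds M N (pos a)
  neg : ∀ {a} → ¬ M a → ReductHolds M N (neg a)

ReductClosed : Program → AtomSet → AtomSet → Set
ReductClosed P M N =
  ∀ {c h} → c ∈ P → head c ≡ just h → All (ReductHolds M N) (body c) → N h

ReductHolds-mono : ∀ {M N N′} → N ⊆ₐ N′ → ∀ {l} → ReductHolds M N l → ReductHolds M N′ l
ReductHolds-mono N⊆N′ (pos Na) = pos (N⊆N′ _ Na)
ReductHolds-mono N⊆N′ (neg ¬Ma) = neg ¬Ma

Holds⇒ReductHolds : ∀ {M} l → Holds M l → ReductHolds M M l
Holds⇒ReductHolds (pos a) Ma = pos Ma
Holds⇒ReductHolds (neg a) ¬Ma = neg ¬Ma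

ReductHolds⇒Holds : ∀ {M l} → ReductHolds M M l → Holds M l
ReductHolds⇒Holds (pos Ma) = Ma
ReductHolds⇒Holds (neg ¬Ma) = ¬Ma

split-body : ∀ {M N} h ls → All (ReductHolds M N) ls →
             All N (b⁺ (h ⇐ ls)) × All (λ a → ¬ M a) (b⁻ (h ⇐ ls))
split-body _ [] [] = [] , []
split-body h (pos a ∷ ls) (pos Na ∷ hs) with split-body h ls hs
... | N⁺ , ¬M⁻ = Na ∷ N⁺ , ¬M⁻
split-body h (neg a ∷ ls) (neg ¬Ma ∷ hs) with split-body h ls hs
... | N⁺ , ¬M⁻ = N⁺ , ¬Ma ∷ ¬M⁻

join-body : ∀ {M N} h ls → All N (b⁺ (h ⇐ ls)) → All (λ a → ¬ M a) (b⁻ (h ⇐ ls)) →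
            All (ReductHolds M N) ls
join-body _ [] _ _ = []
join-body h (pos a ∷ ls) (Na ∷ N⁺) ¬M⁻ = pos Na ∷ join-body h ls N⁺ ¬M⁻
join-body h (neg a ∷ ls) N⁺ (¬Ma ∷ ¬M⁻) = neg ¬Ma ∷ join-body h ls N⁺ ¬M⁻

IsModel⇒ReductClosed : ∀ {P M N} → IsModel (Reduct P M) N → ReductClosed P M N
IsModel⇒ReductClosed model {c} {h} c∈P h≡ holds with split-body (head c) (body c) holds
... | N⁺ , ¬M⁻ = model (h ←⁺ b⁺ c) (c , c∈P , h≡ , refl , ¬M⁻) N⁺

ReductClosed⇒IsModel : ∀ {P M N} → ReductClosed P M N → IsModel (Reduct P M) N
ReductClosed⇒IsModel closed (h ←⁺ _) (c , c∈P , h≡ , refl , ¬M⁻) N⁺ =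
  closed c∈P h≡ (join-body (head c) (body c) N⁺ ¬M⁻)

module _ {P M} (stable : StableModel P M) where

  stable-closed : ReductClosed P M M
  stable-closed = IsModel⇒ReductClosed (proj₁ (proj₂ (proj₂ stable)))

  stable-least : ∀ N → ReductClosed P M N → M ⊆ₐ N
  stable-least N closed = proj₂ (proj₂ (proj₂ stable)) N (ReductClosed⇒IsModel closed)

≐-sym : ∀ {M N} → M ≐ N → N ≐ M
≐-sym (M⊆N , N⊆M) = N⊆M , M⊆N

Holds-≐ : ∀ {M N} → M ≐ N → ∀ l → Holds M l → Holds N l
Holds-≐ (M⊆N , N⊆M) (pos a) = M⊆N a
Holds-≐ (M⊆N , N⊆M) (neg a) ¬Ma = ¬Ma ∘ N⊆M a

Reduct-≐ : ∀ {P M N} → M ≐ N → ∀ d → Reduct P M d → Reduct P N d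
Reduct-≐ (_ , N⊆M) d (c , c∈P , h≡ , b≡ , ¬M⁻) =
  c , c∈P , h≡ , b≡ , All.map (λ ¬Ma → ¬Ma ∘ N⊆M _) ¬M⁻

stable-≐ : ∀ {P M N} → M ≐ N → StableModel P M → StableModel P N
stable-≐ M≐N@(M⊆N , N⊆M) (M⊆At , sat , model , least) =
  (λ a → M⊆At a ∘ N⊆M a) ,
  (λ c c∈P h≡ holds → sat c c∈P h≡ (All.map (λ {l} → Holds-≐ (≐-sym M≐N) l) holds)) ,
  (λ d r N⁺ → M⊆N _ (model d (Reduct-≐ (≐-sym M≐N) d r) (All.map (N⊆M _) N⁺))) ,
  (λ K closed a → least K (λ d r → closed d (Reduct-≐ M≐N d r)) a ∘ N⊆M a)

ConsistentWith⇒Consistent : ∀ {M L} → ConsistentWith M L → Consistent L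
ConsistentWith⇒Consistent (L⁺⊆M , L⁻∩M) a a∈L ¬a∈L = L⁻∩M a ¬a∈L (L⁺⊆M a a∈L)

Consistent⇒ConsistentWith-Pos : ∀ {L} → Consistent L → ConsistentWith (Pos L) L
Consistent⇒ConsistentWith-Pos L-cons = (λ a a∈L → a∈L) , λ a ¬a∈L a∈L → L-cons a a∈L ¬a∈L

ConsistentWith-≐ : ∀ {M N} L → M ≐ N → ConsistentWith M L → ConsistentWith N L
ConsistentWith-≐ L (M⊆N , N⊆M) (L⁺⊆M , L⁻∩M) =
  (λ a → M⊆N a ∘ L⁺⊆M a) , λ a ¬a∈L → L⁻∩M a ¬a∈L ∘ N⊆M a

ConsistentWith⇒Holds : ∀ {M L l} → ConsistentWith M L → l ∈ L → Holds M l
ConsistentWith⇒Holds {l = pos a} (L⁺⊆M , _) = L⁺⊆M a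
ConsistentWith⇒Holds {l = neg a} (_ , L⁻∩M) = L⁻∩M a

ConsistentWith⇒¬Holds : ∀ {M L l} → ConsistentWith M L → negate l ∈ L → ¬ Holds M l
ConsistentWith⇒¬Holds {l = pos a} (_ , L⁻∩M) = L⁻∩M a
ConsistentWith⇒¬Holds {l = neg a} (L⁺⊆M , _) a∈L ¬Ma = ¬Ma (L⁺⊆M a a∈L)

ConsistentWith-++⁻ˡ : ∀ {M} L {A} → ConsistentWith M (L ++ A) → ConsistentWith M L
ConsistentWith-++⁻ˡ L (LA⁺⊆M , LA⁻∩M) = (λ a → LA⁺⊆M a ∘ ∈-++⁺ˡ) , λ a → LA⁻∩M a ∘ ∈-++⁺ˡ

ConsistentWith-++⁺ : ∀ {M} L {A} → ConsistentWith M L → ConsistentWith M A → ConsistentWith M (L ++ A)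
ConsistentWith-++⁺ L (L⁺⊆M , L⁻∩M) (A⁺⊆M , A⁻∩M) =
  (λ a → [ L⁺⊆M a , A⁺⊆M a ]′ ∘ ∈-++⁻ L) , λ a → [ L⁻∩M a , A⁻∩M a ]′ ∘ ∈-++⁻ L

ConsistentWith-∩⁻ : ∀ {M S A} → (∀ l → l ∈ A → S (atomOf l)) →
                    ConsistentWith (M ∩ S) A → ConsistentWith M A
ConsistentWith-∩⁻ A⊆S (A⁺⊆M∩S , A⁻∩M∩S) =
  (λ a → proj₁ ∘ A⁺⊆M∩S a) , λ a ¬a∈A Ma → A⁻∩M∩S a ¬a∈A (Ma , A⊆S (neg a) ¬a∈A)

Holds-∩⁻ : ∀ {M S} l → S (atomOf l) → Holds (M ∩ S) l → Holds M l
Holds-∩⁻ (pos a) _ = proj₁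
Holds-∩⁻ (neg a) Sa ¬M∩Sa Ma = ¬M∩Sa (Ma , Sa)

Removed⇒head-Covered : ∀ {M N L c} → N ⊆ₐ M → ConsistentWith M L →
                       All (ReductHolds M N) (body c) → Removed L c →
                       ∃[ h ] head c ≡ just h × Covered L h
Removed⇒head-Covered N⊆M M∼L holds (clash l∈c ¬l∈L) =
  ⊥-elim (ConsistentWith⇒¬Holds M∼L ¬l∈L (ReductHolds⇒Holds (ReductHolds-mono N⊆M (All.lookup holds l∈c))))
Removed⇒head-Covered _ _ _ (fixed h≡ h-cov) = _ , h≡ , h-cov

-- Stable models of [P]_L

module _ {P M L} (stable : StableModel P M) (M∼L : ConsistentWith M L) where

  simplify-[]⇒Pos≐ : simplify P L ≡ [] → Pos L ≐ M
  simplify-[]⇒Pos≐ Q≡[] = proj₁ M∼L , stable-least stable (Pos L) closed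
    where
    closed : ReductClosed P M (Pos L)
    closed {c} c∈P refl holds with Removed? L c
    ... | no ¬rem = ⊥-elim (¬Any[] (subst (simplifyClause L c ∈_) Q≡[] (∈-simplify⁺ P L c∈P ¬rem)))
    ... | yes rem with Removed⇒head-Covered (proj₁ M∼L) M∼L holds rem
    ...   | _ , refl , inj₁ h∈L = h∈L
    ...   | _ , refl , inj₂ ¬h∈L = ⊥-elim (proj₂ M∼L _ ¬h∈L
                                       (stable-closed stable c∈P refl (All.map (ReductHolds-mono (proj₁ M∼L)) holds)))

  private
    Q = simplify P L
    M′ = M ∩ At Q

  restrict-body : ∀ {c} → simplifyClause L c ∈ Q →
                  All (Holds M′) (body (simplifyClause L c)) → All (Holds M) (body c)
  restrict-body {c} c′∈Q holds = All.tabulate λ {l} l∈c →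
    [ ConsistentWith⇒Holds M∼L
    , (λ l∈c′ → Holds-∩⁻ l (body-At c′∈Q l∈c′) (All.lookup holds l∈c′))
    ]′ (∈-simplifyClause⁺ L c l∈c)

  simplify-stable : StableModel Q M′
  simplify-stable =
    (λ _ → proj₂) , satisfies , ReductClosed⇒IsModel closed , λ N → least N ∘ IsModel⇒ReductClosed
    where
    satisfies : SatConstraints Q M′
    satisfies c′ c′∈Q h≡nothing holds with ∈-simplify⁻ P L c′∈Q
    ... | c , c∈P , _ , refl = proj₁ (proj₂ stable) c c∈P h≡nothing (restrict-body c′∈Q holds)

    closed : ReductClosed Q M′ M′
    closed c′∈Q h≡ holds with ∈-simplify⁻ P L c′∈Q
    ... | c , c∈P , _ , refl =
      stable-closed stable c∈P h≡
        (All.map (Holds⇒ReductHolds _) (restrict-body c′∈Q (All.map ReductHolds⇒Holds holds)))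
      , head-At c′∈Q h≡

    least : ∀ N → ReductClosed Q M′ N → M′ ⊆ₐ N
    least N closedN a (Ma , a∈Q) = proj₂ (stable-least stable K closedK a Ma) a∈Q
      where
      K : AtomSet
      K x = M x × (At Q x → N x)

      restrictK : ∀ {l} → At Q (atomOf l) → ReductHolds M K l → ReductHolds M′ N l
      restrictK l∈Q (pos Ka) = pos (proj₂ Ka l∈Q)
      restrictK _ (neg ¬Ma) = neg (¬Ma ∘ proj₁)

      closedK : ReductClosed P M K
      closedK {c} {h} c∈P refl holds =
        stable-closed stable c∈P refl (All.map (ReductHolds-mono (λ _ → proj₁)) holds) , N-head
        where
        N-head : At Q h → N h
        N-head h∈Q with Removed? L c
        ... | no ¬rem = closedN c′∈Q refl (All.tabulate λ l∈c′ →
                restrictK (body-At c′∈Q l∈c′) (All.lookup holds (proj₁ (∈-simplifyClause⁻ L c l∈c′))))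
          where c′∈Q = ∈-simplify⁺ P L c∈P ¬rem
        ... | yes rem with Removed⇒head-Covered (λ _ → proj₁) M∼L holds rem
        ...   | _ , refl , h-cov = ⊥-elim (proj₂ (At-simplify⁻ P L h∈Q) h-cov)

-- Termination measure

module _ {a p q} {A : Set a} {P : Pred A p} {Q : Pred A q}
         (P? : Decidable P) (Q? : Decidable Q) (P⇒Q : ∀ {x} → P x → Q x) where

  length-filter-mono : ∀ xs → length (filter P? xs) ≤ length (filter Q? xs)
  length-filter-mono [] = z≤n
  length-filter-mono (x ∷ xs) with P? x | Q? x
  ... | yes _  | yes _  = s≤s (length-filter-mono xs)
  ... | yes Px | no ¬Qx = ⊥-elim (¬Qx (P⇒Q Px))
  ... | no _   | yes _  = m≤n⇒m≤1+n (length-filter-mono xs)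
  ... | no _   | no _   = length-filter-mono xs

  length-filter-< : ∀ {xs} → Any (λ x → Q x × ¬ P x) xs →
                    length (filter P? xs) < length (filter Q? xs)
  length-filter-< {x ∷ xs} (here (Qx , ¬Px)) with P? x | Q? x
  ... | yes Px | _      = ⊥-elim (¬Px Px)
  ... | no _   | yes _  = s≤s (length-filter-mono xs)
  ... | no _   | no ¬Qx = ⊥-elim (¬Qx Qx)
  length-filter-< {x ∷ xs} (there Q¬P) with P? x | Q? x
  ... | yes _  | yes _  = s≤s (length-filter-< Q¬P)
  ... | yes Px | no ¬Qx = ⊥-elim (¬Qx (P⇒Q Px))
  ... | no _   | yes _  = m≤n⇒m≤1+n (length-filter-< Q¬P)
  ... | no _   | no _   = length-filter-< Q¬P

clauseAtoms : Clause → List ℕ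
clauseAtoms c = fromMaybe (head c) ++ map atomOf (body c)

atoms : Program → List ℕ
atoms = concatMap clauseAtoms

OccursIn⇒∈clauseAtoms : ∀ {a} c → OccursIn a c → a ∈ clauseAtoms c
OccursIn⇒∈clauseAtoms (just a ⇐ ls) (inj₁ refl) = here refl
OccursIn⇒∈clauseAtoms (h ⇐ ls) (inj₂ a∈ls) =
  ∈-++⁺ʳ (fromMaybe h) (map⁺ (Any.map sym a∈ls))

At⇒∈atoms : ∀ {P a} → At P a → a ∈ atoms P
At⇒∈atoms a∈P = ∈-concatMap⁺ clauseAtoms (Any.map (OccursIn⇒∈clauseAtoms _) a∈P)

uncovered : Program → List Literal → ℕ
uncovered P L = length (filter (¬? ∘ Covered? L) (atoms P))

uncovered-++-< : ∀ P L {A} → A ≢ [] → A ⊆Lit simplify P L → uncovered P (L ++ A) < uncovered P L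
uncovered-++-< P L {[]} A≢[] _ = ⊥-elim (A≢[] refl)
uncovered-++-< P L {A@(l ∷ _)} _ A⊆Q with At-simplify⁻ P L (A⊆Q l (here refl))
... | l∈P , ¬l-cov =
  length-filter-< (¬? ∘ Covered? (L ++ A)) (¬? ∘ Covered? L) (λ ¬cov → ¬cov ∘ Covered-++⁺ˡ A)
    (lose (At⇒∈atoms l∈P) (¬l-cov , λ ¬cov → ¬cov (∈⇒Covered (∈-++⁺ʳ L (here refl)))))

module _ (P : Program) (complete : Program → List (List Literal)) where

  outputs-sound : ∀ {L N} → Outputs P complete L N → StableModel P N × ConsistentWith N L
  outputs-sound (out-base L-cons _ stable) = stable , Consistent⇒ConsistentWith-Pos L-cons
  outputs-sound (out-rec {L} _ _ _ out) with outputs-sound out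
  ... | stable , N∼LA = stable , ConsistentWith-++⁻ˡ L N∼LA

  module _ (P-definite : Definite P)
           (complete-correct : ∀ Q → Definite Q → Q ≢ [] → Complete Q (complete Q))
           {M} (stable : StableModel P M) where

    extend-by-complete : ∀ {L} → ConsistentWith M L → simplify P L ≢ [] →
                         ∃[ A ] A ∈ complete (simplify P L)
                                × uncovered P (L ++ A) < uncovered P L
                                × ConsistentWith M (L ++ A)
    extend-by-complete {L} M∼L Q≢[]
      with complete-correct (simplify P L) (simplify-definite L P-definite) Q≢[]
    ... | _ , As-ok , covers with find (covers _ (simplify-stable stable M∼L))
    ...   | A , A∈ , M′∼A with All.lookup As-ok A∈
    ...     | A≢[] , A⊆Q =
      A , A∈ , uncovered-++-< P L A≢[] A⊆Q ,
      ConsistentWith-++⁺ L M∼L (ConsistentWith-∩⁻ A⊆Q M′∼A)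

    outputs-complete : ∀ {L} → Acc _<_ (uncovered P L) → ConsistentWith M L →
                       ∃[ N ] Outputs P complete L N × N ≐ M
    outputs-complete {L} (acc rec) M∼L with simplify P L in Q≡
    ... | [] = Pos L , out-base L-cons Q≡ (stable-≐ (≐-sym Pos≐M) stable) , Pos≐M
      where
      Pos≐M = simplify-[]⇒Pos≐ stable M∼L Q≡
      L-cons = ConsistentWith⇒Consistent M∼L
    ... | _ ∷ _ = recurse λ Q≡[] → case trans (sym Q≡) Q≡[] of λ ()
      where
      recurse : simplify P L ≢ [] → ∃[ N ] Outputs P complete L N × N ≐ M
      recurse Q≢[] with extend-by-complete M∼L Q≢[]
      ... | A , A∈ , smaller , M∼LA with outputs-complete (rec smaller) M∼LA
      ...   | N , out , N≐M = N , out-rec (ConsistentWith⇒Consistent M∼L) Q≢[] A∈ out , N≐M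

proposition3 : (P : Program) → Definite P
    → (complete : Program → List (List Literal))
    → (∀ (Q : Program) → Definite Q → Q ≢ [] → Complete Q (complete Q))
    → (L : List Literal) → L ⊆Lit P
    → (M : AtomSet)
    → (Σ AtomSet (λ N → Outputs P complete L N × (N ≐ M)))
      ⇔ (StableModel P M × ConsistentWith M L)
proposition3 P P-definite complete complete-correct L _ M = mk⇔ sound complete′
  where
  sound : ∃[ N ] Outputs P complete L N × N ≐ M → StableModel P M × ConsistentWith M L
  sound (N , out , N≐M) with outputs-sound P complete out
  ... | N-stable , N∼L = stable-≐ N≐M N-stable , ConsistentWith-≐ L N≐M N∼L

  complete′ : StableModel P M × ConsistentWith M L → ∃[ N ] Outputs P complete L N × N ≐ M
  complete′ (M-stable , M∼L) =
    outputs-complete P complete P-definite complete-correct M-stable (<-wellFounded _) M∼L
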